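{- Let $\mathbb{V}=U\oplus W$ be an $n$-dimensional vector space over the field $\mathbb{F}_q$ with $q=2$, where $U,W$ are nonzero subspaces with $\dim U=r$, $\dim W=s$, $r+s=n\geq 4$. Then the chromatic number of the direct sum graph satisfies $$2^{n-2}\leq \chi(\Gamma_{U\oplus W}(\mathbb{V}))\leq \frac{q^n-(q^r+q^s+rs)}{2}+2^{n-3}+1.$$
   Context: Fix a basis $\{\alpha_1,\dots,\alpha_r\}$ of $U$ and a basis $\{\beta_1,\dots,\beta_s\}$ of $W$; every $x\in\mathbb{V}$ is written uniquely as $x=\sum_i a_i\alpha_i+\sum_j b_j\beta_j$. The direct sum graph $\Gamma_{U\oplus W}(\mathbb{V})$ is the simple graph whose vertex set is $\{x=u+w: u\in U, w\in W, u\neq 0, w\neq 0\}$, in which two distinct vertices $x,y$ are adjacent iff there is an index $i$ such that the coefficient of $\alpha_i$ is nonzero in both $x$ and $y$, and there is an index $j$ such that the coefficient of $\beta_j$ is nonzero in both $x$ and $y$. The chromatic number is the minimum number of colors in a proper vertex coloring. -}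

module Defs where

open import Data.Nat using (ℕ; _≤_)
open import Data.Bool using (Bool; true)
open import Data.Fin using (Fin)
open import Data.Vec using (Vec; lookup)
open import Data.Product using (Σ; ∃; _×_; _,_)
open import Relation.Binary.PropositionalEquality using (_≡_; _≢_)

-- The field F_2 is represented by Bool (true = 1 ≠ 0).
-- A vector x = Σ a_i α_i + Σ b_j β_j of V = U ⊕ W (dim U = r, dim W = s)
-- is represented by its coordinate pair (a , b) w.r.t. the fixed bases.
Vect : ℕ → ℕ → Set
Vect r s = Vec Bool r × Vec Bool s

NonzeroV : ∀ {m} → Vec Bool m → Set
NonzeroV {m} v = Σ (Fin m) λ i → lookup v i ≡ true

IsVertex : ∀ {r s} → Vect r s → Set
IsVertex (a , b) = NonzeroV a × NonzeroV b

CommonSupport : ∀ {m} → Vec Bool m → Vec Bool m → Set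
CommonSupport {m} v w = Σ (Fin m) λ i → (lookup v i ≡ true) × (lookup w i ≡ true)

Adjacent : ∀ {r s} → Vect r s → Vect r s → Set
Adjacent x@(a , b) y@(a' , b') = (x ≢ y) × CommonSupport a a' × CommonSupport b b'

-- proper colouring of Γ_{U⊕W}(V) with k colours (values on non-vertices irrelevant)
ProperColoring : (r s k : ℕ) → (Vect r s → Fin k) → Set
ProperColoring r s k c =
  ∀ x y → IsVertex x → IsVertex y → Adjacent x y → c x ≢ c y

Colorable : (r s k : ℕ) → Set
Colorable r s k = Σ (Vect r s → Fin k) (ProperColoring r s k)

IsChromaticNumber : (r s χ : ℕ) → Set
IsChromaticNumber r s χ = Colorable r s χ × (∀ k → Colorable r s k → χ ≤ k)

-- Over F₂ a nonzero vector v and its complement v + (1,…,1) have disjoint supports, so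
-- colouring a vertex (a , b) by the pair of classes {a , aᶜ} and {b , bᶜ} is proper: two
-- adjacent vertices with the same colour would have a = a' and b = b'.  This uses
-- 2^(r-1) · 2^(s-1) = 2^(n-2) colours, and the vertices whose first U- and first
-- W-coordinates are both 1 form a clique of that size, so χ = 2^(n-2).  The upper bound
-- of the paper then reduces to (2^r - 2)(2^s - 2) ≥ 0 together with 2r ≤ 2^r.
module Submission where

open import Data.Bool using (Bool; true; false; not)
open import Data.Bool.Properties using (not-involutive; not-¬)
open import Data.Fin using (Fin; _≟_)
open import Data.Fin.Properties using (2↔Bool; *↔×; injective⇒≤)
open import Data.Nat using (ℕ; zero; suc; _+_; _*_; _∸_; _^_; _≤_; _/_; z≤n; s≤s)
open import Data.Nat.DivMod using (m*n/n≡m; /-monoˡ-≤)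
open import Data.Nat.Properties
  using ( ≤-refl; ≤-reflexive; ≤-trans; n≤1+n; m≤m+n; m+n≤o⇒m≤o∸n; +-suc; +-identityʳ; *-suc
        ; +-mono-≤; +-monoˡ-≤; +-monoʳ-≤; *-mono-≤; *-monoʳ-≤; *-cancelˡ-≤
        ; m^n>0; ^-monoʳ-≤; ^-distribˡ-+-*; module ≤-Reasoning )
open import Data.Nat.Tactic.RingSolver using (solve-∀)
open import Data.Product using (∃; _×_; _,_)
import Data.Product as Product
open import Data.Product.Algebra using (×-cong)
open import Data.Product.Properties using (,-injectiveˡ; ,-injectiveʳ)
open import Data.Sum using (_⊎_; inj₁; inj₂)
open import Data.Vec using (Vec; _∷_; map; tail)
open import Data.Vec.Properties using (map-∘; map-cong; map-id; lookup-map)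
open import Data.Vec.Recursive using (lift↔; Fin[m^n]↔Fin[m]^n)
open import Data.Vec.Recursive.Properties using (↔Vec)
open import Function.Bundles using (_↔_; Inverse; Injection)
open import Function.Properties.Inverse using (↔-sym; ↔-trans; ↔⇒↣)
open import Relation.Binary.PropositionalEquality
open import Relation.Nullary using (yes; no; ¬_; contradiction)
open import Defs

complement : ∀ {n} → Vec Bool n → Vec Bool n
complement = map not

complement-involutive : ∀ {n} (v : Vec Bool n) → complement (complement v) ≡ v
complement-involutive v =
  trans (sym (map-∘ not not v)) (trans (map-cong not-involutive v) (map-id v))

complement-injective : ∀ {n} {v w : Vec Bool n} → complement v ≡ complement w → v ≡ w
complement-injective {v = v} {w} vᶜ≡wᶜ =
  trans (sym (complement-involutive v)) (trans (cong complement vᶜ≡wᶜ) (complement-involutive w))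

≡complement⇒¬CommonSupport : ∀ {n} {v w : Vec Bool n} → v ≡ complement w → ¬ CommonSupport v w
≡complement⇒¬CommonSupport {w = w} refl (i , wᶜᵢ≡true , wᵢ≡true) =
  not-¬ refl (trans wᵢ≡true (trans (sym wᶜᵢ≡true) (lookup-map i not w)))

-- The member of {v , complement v} with leading coordinate 1, that coordinate dropped.
normalise : ∀ {n} → Vec Bool (suc n) → Vec Bool n
normalise (true ∷ v) = v
normalise (false ∷ v) = complement v

normalise-≡⇒≡⊎≡complement : ∀ {n} (v w : Vec Bool (suc n)) →
  normalise v ≡ normalise w → v ≡ w ⊎ v ≡ complement w
normalise-≡⇒≡⊎≡complement (true ∷ v) (true ∷ w) e = inj₁ (cong (true ∷_) e)
normalise-≡⇒≡⊎≡complement (false ∷ v) (false ∷ w) e = inj₁ (cong (false ∷_) (complement-injective e))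
normalise-≡⇒≡⊎≡complement (true ∷ v) (false ∷ w) e = inj₂ (cong (true ∷_) e)
normalise-≡⇒≡⊎≡complement (false ∷ v) (true ∷ w) e =
  inj₂ (cong (false ∷_) (trans (sym (complement-involutive v)) (cong complement e)))

normalise-injective-on-CommonSupport : ∀ {n} {v w : Vec Bool (suc n)} →
  CommonSupport v w → normalise v ≡ normalise w → v ≡ w
normalise-injective-on-CommonSupport {v = v} {w} v∩w e with normalise-≡⇒≡⊎≡complement v w e
... | inj₁ v≡w = v≡w
... | inj₂ v≡wᶜ = contradiction v∩w (≡complement⇒¬CommonSupport v≡wᶜ)

clique⇒≤ : ∀ {r s m k} (D : Fin m → Vect r s) →
  (∀ i → IsVertex (D i)) → (∀ {i j} → i ≢ j → Adjacent (D i) (D j)) →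
  Colorable r s k → m ≤ k
clique⇒≤ D isVertex adjacent (c , proper) = injective⇒≤ c∘D-injective
  where
  c∘D-injective : ∀ {i j} → c (D i) ≡ c (D j) → i ≡ j
  c∘D-injective {i} {j} same with i ≟ j
  ... | yes i≡j = i≡j
  ... | no i≢j = contradiction same (proper (D i) (D j) (isVertex i) (isVertex j) (adjacent i≢j))

Fin[2^n]↔BoolVec : ∀ n → Fin (2 ^ n) ↔ Vec Bool n
Fin[2^n]↔BoolVec n = ↔-trans (Fin[m^n]↔Fin[m]^n 2 n) (↔-trans (lift↔ n 2↔Bool) (↔Vec n))

Fin[2^r*2^s]↔BoolVec×BoolVec : ∀ r s → Fin (2 ^ r * 2 ^ s) ↔ (Vec Bool r × Vec Bool s)
Fin[2^r*2^s]↔BoolVec×BoolVec r s = ↔-trans *↔× (×-cong (Fin[2^n]↔BoolVec r) (Fin[2^n]↔BoolVec s))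

module _ (r s : ℕ) where

  private
    colours↔ : Fin (2 ^ r * 2 ^ s) ↔ (Vec Bool r × Vec Bool s)
    colours↔ = Fin[2^r*2^s]↔BoolVec×BoolVec r s

    open Inverse colours↔ using (to; from)

  complementClassColouring : Vect (suc r) (suc s) → Fin (2 ^ r * 2 ^ s)
  complementClassColouring (a , b) = from (normalise a , normalise b)

  complementClassColouring-proper : ProperColoring (suc r) (suc s) (2 ^ r * 2 ^ s) complementClassColouring
  complementClassColouring-proper (a , b) (a' , b') _ _ (x≢y , a∩a' , b∩b') same = x≢y (cong₂ _,_
    (normalise-injective-on-CommonSupport a∩a' (,-injectiveˡ normalised≡))
    (normalise-injective-on-CommonSupport b∩b' (,-injectiveʳ normalised≡)))
    where
    normalised≡ : (normalise a , normalise b) ≡ (normalise a' , normalise b')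
    normalised≡ = Injection.injective (↔⇒↣ (↔-sym colours↔)) same

  leadingOnesClique : Fin (2 ^ r * 2 ^ s) → Vect (suc r) (suc s)
  leadingOnesClique i = Product.map (true ∷_) (true ∷_) (to i)

  leadingOnesClique-isVertex : ∀ i → IsVertex (leadingOnesClique i)
  leadingOnesClique-isVertex i = (Fin.zero , refl) , (Fin.zero , refl)

  leadingOnesClique-adjacent : ∀ {i j} → i ≢ j → Adjacent (leadingOnesClique i) (leadingOnesClique j)
  leadingOnesClique-adjacent i≢j =
    (λ e → i≢j (Injection.injective (↔⇒↣ colours↔) (cong (Product.map tail tail) e))) ,
    (Fin.zero , refl , refl) , (Fin.zero , refl , refl)

  chromaticNumber : IsChromaticNumber (suc r) (suc s) (2 ^ r * 2 ^ s)
  chromaticNumber =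
    (complementClassColouring , complementClassColouring-proper) ,
    λ _ → clique⇒≤ leadingOnesClique leadingOnesClique-isVertex leadingOnesClique-adjacent

2*n≤2^n : ∀ n → 2 * n ≤ 2 ^ n
2*n≤2^n zero = z≤n
2*n≤2^n (suc zero) = ≤-refl
2*n≤2^n (suc n@(suc _)) = begin
  2 * suc n     ≡⟨ *-suc 2 n ⟩
  2 + 2 * n     ≤⟨ +-mono-≤ (^-monoʳ-≤ 2 {1} {n} (s≤s z≤n)) (2*n≤2^n n) ⟩
  2 ^ n + 2 ^ n ≡⟨ cong (2 ^ n +_) (+-identityʳ (2 ^ n)) ⟨
  2 ^ suc n     ∎
  where open ≤-Reasoning

2*[m+n]≤m*n+4 : ∀ {m n} → 2 ≤ m → 2 ≤ n → 2 * (m + n) ≤ m * n + 4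
2*[m+n]≤m*n+4 {suc (suc m)} {suc (suc n)} (s≤s (s≤s _)) (s≤s (s≤s _)) =
  ≤-trans (m≤m+n _ (m * n)) (≤-reflexive (expand m n))
  where
  expand : ∀ m n → 2 * (2 + m + (2 + n)) + m * n ≡ (2 + m) * (2 + n) + 4
  expand = solve-∀

4*[2^r+2^s+r*s]≤3*2^r*2^s+8 : ∀ {r s} → 1 ≤ r → 1 ≤ s →
  4 * (2 ^ r + 2 ^ s + r * s) ≤ 3 * (2 ^ r * 2 ^ s) + 8
4*[2^r+2^s+r*s]≤3*2^r*2^s+8 {r} {s} 1≤r 1≤s = begin
  4 * (P + Q + r * s)               ≡⟨ regroup P Q r s ⟩
  2 * (2 * (P + Q)) + 2 * r * (2 * s)
    ≤⟨ +-mono-≤ (*-monoʳ-≤ 2 (2*[m+n]≤m*n+4 (2≤2^ 1≤r) (2≤2^ 1≤s)))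
                (*-mono-≤ (2*n≤2^n r) (2*n≤2^n s)) ⟩
  2 * (P * Q + 4) + P * Q           ≡⟨ collect (P * Q) ⟩
  3 * (P * Q) + 8                   ∎
  where
  open ≤-Reasoning
  P = 2 ^ r
  Q = 2 ^ s
  2≤2^ : ∀ {n} → 1 ≤ n → 2 ≤ 2 ^ n
  2≤2^ = ^-monoʳ-≤ 2
  regroup : ∀ P Q r s → 4 * (P + Q + r * s) ≡ 2 * (2 * (P + Q)) + 2 * r * (2 * s)
  regroup = solve-∀
  collect : ∀ PQ → 2 * (PQ + 4) + PQ ≡ 3 * PQ + 8
  collect = solve-∀

2*m≤[8*m∸a]/2+m+1 : ∀ m a → 1 ≤ m → 4 * a ≤ 3 * (8 * m) + 8 → 2 * m ≤ (8 * m ∸ a) / 2 + m + 1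
2*m≤[8*m∸a]/2+m+1 (suc h) a _ 4a≤ = begin
  2 * suc h                       ≡⟨ split h ⟩
  h + suc h + 1                   ≤⟨ +-monoˡ-≤ 1 (+-monoˡ-≤ (suc h) h≤half) ⟩
  (8 * suc h ∸ a) / 2 + suc h + 1 ∎
  where
  open ≤-Reasoning
  split : ∀ h → 2 * suc h ≡ h + suc h + 1
  split = solve-∀
  factor : ∀ h → 3 * (8 * suc h) + 8 ≡ 4 * (6 * suc h + 2)
  factor = solve-∀
  fill : ∀ h → h * 2 + (6 * suc h + 2) ≡ 8 * suc h
  fill = solve-∀
  a≤ : a ≤ 6 * suc h + 2
  a≤ = *-cancelˡ-≤ 4 (≤-trans 4a≤ (≤-reflexive (factor h)))
  2h≤ : h * 2 ≤ 8 * suc h ∸ a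
  2h≤ = m+n≤o⇒m≤o∸n (h * 2) (≤-trans (+-monoʳ-≤ (h * 2) a≤) (≤-reflexive (fill h)))
  h≤half : h ≤ (8 * suc h ∸ a) / 2
  h≤half = subst (_≤ (8 * suc h ∸ a) / 2) (m*n/n≡m h 2) (/-monoˡ-≤ 2 2h≤)

2^[n∸2]≤[2^n∸a]/2+2^[n∸3]+1 : ∀ n a → 3 ≤ n → 4 * a ≤ 3 * 2 ^ n + 8 →
  2 ^ (n ∸ 2) ≤ (2 ^ n ∸ a) / 2 + 2 ^ (n ∸ 3) + 1
2^[n∸2]≤[2^n∸a]/2+2^[n∸3]+1 (suc (suc (suc m))) a (s≤s (s≤s (s≤s _))) =
  subst (λ 2^n → 4 * a ≤ 3 * 2^n + 8 → 2 * 2 ^ m ≤ (2^n ∸ a) / 2 + 2 ^ m + 1)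
        (sym (^-distribˡ-+-* 2 3 m))
        (2*m≤[8*m∸a]/2+m+1 (2 ^ m) a (m^n>0 2 m))

2^[n∸2]≤upperBound : ∀ r s → 1 ≤ r → 1 ≤ s → 3 ≤ r + s →
  2 ^ (r + s ∸ 2) ≤ (2 ^ (r + s) ∸ (2 ^ r + 2 ^ s + r * s)) / 2 + 2 ^ (r + s ∸ 3) + 1
2^[n∸2]≤upperBound r s 1≤r 1≤s 3≤n =
  2^[n∸2]≤[2^n∸a]/2+2^[n∸3]+1 (r + s) (2 ^ r + 2 ^ s + r * s) 3≤n
    (subst (λ 2^n → 4 * (2 ^ r + 2 ^ s + r * s) ≤ 3 * 2^n + 8)
           (sym (^-distribˡ-+-* 2 r s))
           (4*[2^r+2^s+r*s]≤3*2^r*2^s+8 1≤r 1≤s))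

corollary4p7 : (r s : ℕ) → 1 ≤ r → 1 ≤ s → 4 ≤ r + s →
    ∃ λ χ → IsChromaticNumber r s χ
      × 2 ^ (r + s ∸ 2) ≤ χ
      × χ ≤ (2 ^ (r + s) ∸ (2 ^ r + 2 ^ s + r * s)) / 2 + 2 ^ (r + s ∸ 3) + 1
corollary4p7 (suc r) (suc s) 1≤r 1≤s 4≤n =
  2 ^ r * 2 ^ s , chromaticNumber r s , ≤-reflexive 2^[n∸2]≡χ ,
  ≤-trans (≤-reflexive (sym 2^[n∸2]≡χ)) (2^[n∸2]≤upperBound (suc r) (suc s) 1≤r 1≤s (≤-trans (n≤1+n 3) 4≤n))
  where
  2^[n∸2]≡χ : 2 ^ (suc r + suc s ∸ 2) ≡ 2 ^ r * 2 ^ s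
  2^[n∸2]≡χ = trans (cong (λ k → 2 ^ (k ∸ 1)) (+-suc r s)) (^-distribˡ-+-* 2 r s)
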